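{- Let $X$ be a finite set, $N=\{1,\dots,n\}$, and let $\mathcal{D}\subseteq\mathcal{R}(X)$ be a closed Condorcet domain. Let $\mathcal{W}$ be an order preserving structure of winning coalitions on $\mathcal{D}$, and define $F_{\mathcal{W}}:\mathcal{D}^n\to X$ by $F_{\mathcal{W}}(R_1,\dots,R_n)=\tau(R_{\mathcal{W}})$, the top-ranked alternative of $R_{\mathcal{W}}$. Then $F_{\mathcal{W}}$ is strategy-proof: for all $i\in N$, all $R_i,R_i'\in\mathcal{D}$ and all $R_{ -i}\in\mathcal{D}^{n-1}$, the alternative $F_{\mathcal{W}}(R_i,R_{ -i})$ either equals $F_{\mathcal{W}}(R_i',R_{ -i})$ or is ranked above it by $R_i$.
   Context: $\mathcal{R}(X)$ is the set of strict linear orders on $X$. A profile over $\mathcal{D}$ is $(R_1,\dots,R_n)\in\mathcal{D}^n$, odd if $n$ is odd; its majority relation ranks $x$ above $y$ iff more than half of the voters do. $\mathcal{D}$ is a Condorcet domain if every such majority relation is acyclic, and closed if the majority relation of every odd profile over $\mathcal{D}$ belongs to $\mathcal{D}$. For distinct $x,y$ let $V_{xy}=\{R\in\mathcal{D}:xRy\}$. A structure of winning coalitions is a family $\mathcal{W}=\{\mathcal{W}_{xy}\}$ indexed by ordered pairs of distinct alternatives, where each $\mathcal{W}_{xy}$ is a non-empty collection of non-empty subsets of $N$, closed under supersets, and for all distinct $x,y$ and all $W\subseteq N$: $W\in\mathcal{W}_{xy}$ iff $N\setminus W\notin\mathcal{W}_{yx}$. It is order preserving on $\mathcal{D}$ if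 $V_{xy}\subseteq V_{zw}$ implies $\mathcal{W}_{xy}\subseteq\mathcal{W}_{zw}$ for all ordered pairs of distinct alternatives $(x,y),(z,w)$. For such $\mathcal{W}$ and any profile $(R_1,\dots,R_n)\in\mathcal{D}^n$ there is a unique $R_{\mathcal{W}}\in\mathcal{D}$ with $xR_{\mathcal{W}}y \iff \{i\in N: xR_iy\}\in\mathcal{W}_{xy}$ for all distinct $x,y$. -}

module Defs where

open import Data.Nat using (ℕ; suc; _+_; _*_; _<_)
open import Data.Fin using (Fin; zero)
import Data.Fin as F
open import Data.Fin.Permutation using (Permutation′; _⟨$⟩ʳ_; _⟨$⟩ˡ_)
open import Data.Fin.Subset using (Subset; ∣_∣; ∁; _⊆_; Nonempty)
open import Data.Vec using (tabulate)
open import Data.Product using (∃; _×_)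
open import Data.Sum using (_⊎_)
open import Relation.Nullary using (¬_; does)
open import Relation.Binary.PropositionalEquality using (_≡_; _≢_)
open import Relation.Binary.Construct.Closure.Transitive using (TransClosure)
open import Function.Bundles using (_⇔_)

-- A strict linear order on X = Fin m, represented by its ranking:
-- the bijection sending an alternative to its position (position 0 = top).
LinOrd : ℕ → Set
LinOrd m = Permutation′ m

_≻⟨_⟩_ : ∀ {m} → Fin m → LinOrd m → Fin m → Set
x ≻⟨ R ⟩ y = (R ⟨$⟩ʳ x) F.< (R ⟨$⟩ʳ y)

top : ∀ {m} → LinOrd (suc m) → Fin (suc m)
top R = R ⟨$⟩ˡ zero

Domain : ℕ → Set₁
Domain m = LinOrd m → Set

Profile : ℕ → ℕ → Set
Profile m k = Fin k → LinOrd m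

_∈ᴰ_ : ∀ {m k} → Profile m k → Domain m → Set
P ∈ᴰ D = ∀ j → D (P j)

coalition : ∀ {m k} → Profile m k → Fin m → Fin m → Subset k
coalition P x y = tabulate (λ i → does ((P i ⟨$⟩ʳ x) F.<? (P i ⟨$⟩ʳ y)))

Odd : ℕ → Set
Odd k = ∃ λ j → k ≡ 1 + 2 * j

majority : ∀ {m k} → Profile m k → Fin m → Fin m → Set
majority {k = k} P x y = k < 2 * ∣ coalition P x y ∣

Acyclic : ∀ {m} → (Fin m → Fin m → Set) → Set
Acyclic M = ∀ x → ¬ TransClosure M x x

IsCondorcet : ∀ {m} → Domain m → Set
IsCondorcet {m} D = ∀ k (P : Profile m k) → Odd k → P ∈ᴰ D → Acyclic (majority P)

-- the relation M "belongs to D": some member of D is exactly M.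
_represents_ : ∀ {m} → LinOrd m → (Fin m → Fin m → Set) → Set
R represents M = ∀ x y → x ≢ y → (x ≻⟨ R ⟩ y ⇔ M x y)

IsClosed : ∀ {m} → Domain m → Set
IsClosed {m} D = ∀ k (P : Profile m k) → Odd k → P ∈ᴰ D →
  ∃ λ R → D R × R represents majority P

V⊆V : ∀ {m} → Domain m → Fin m → Fin m → Fin m → Fin m → Set
V⊆V D x y z w = ∀ R → D R → x ≻⟨ R ⟩ y → z ≻⟨ R ⟩ w

-- W x y C : coalition C ∈ W_xy  (only meaningful for x ≢ y).
Coalitions : ℕ → ℕ → Set₁
Coalitions m n = Fin m → Fin m → Subset n → Set

record IsStructureOfWinningCoalitions {m n} (W : Coalitions m n) : Set where
  field
    nonempty   : ∀ x y → x ≢ y → ∃ λ C → W x y C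
    memberNonempty : ∀ x y → x ≢ y → ∀ C → W x y C → Nonempty C
    upClosed   : ∀ x y → x ≢ y → ∀ C C′ → W x y C → C ⊆ C′ → W x y C′
    duality    : ∀ x y → x ≢ y → ∀ C → (W x y C ⇔ (¬ W y x (∁ C)))

OrderPreserving : ∀ {m n} → Domain m → Coalitions m n → Set
OrderPreserving D W = ∀ x y z w → x ≢ y → z ≢ w →
  V⊆V D x y z w → ∀ C → W x y C → W z w C

-- RW is (a choice of) the map P ↦ R_W: R_W ∈ D and
-- x R_W y ⇔ {i : x R_i y} ∈ W_xy for distinct x, y.
IsAggregator : ∀ {m n} → Domain m → Coalitions m n → (Profile m n → LinOrd m) → Set
IsAggregator D W RW = ∀ P → P ∈ᴰ D →
  D (RW P) × RW P represents (λ x y → W x y (coalition P x y))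

F : ∀ {m n} → (Profile (suc m) n → LinOrd (suc m)) → Profile (suc m) n → Fin (suc m)
F RW P = top (RW P)

deviate : ∀ {m n} → Profile m n → Fin n → LinOrd m → Profile m n
deviate P i R′ j with i F.≟ j
... | Relation.Nullary.yes _ = R′
... | Relation.Nullary.no _ = P j

StrategyProof : ∀ {m n} → Domain (suc m) → (Profile (suc m) n → Fin (suc m)) → Set
StrategyProof D f = ∀ i P R′ → P ∈ᴰ D → D R′ →
  f P ≡ f (deviate P i R′) ⊎ f P ≻⟨ P i ⟩ f (deviate P i R′)

-- The closedness and Condorcet hypotheses, together with order preservation,
-- serve only to make R_W well defined. Here R_W is supplied by the aggregator
-- hypothesis, so the argument needs only upward closure and duality of W.
-- Let a = F(P) and b = F(P′), where P′ is P with voter i's ranking replaced,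
-- and suppose a ≠ b and voter i does not rank a above b.
--   * a tops R_W(P), so C = {j : a P_j b} wins for (a, b).
--   * Since i ∉ C and every other voter is unchanged, C ⊆ C′ = {j : a P′_j b},
--     hence C′ also wins for (a, b), and by duality N ∖ C′ loses for (b, a).
--   * b tops R_W(P′), so {j : b P′_j a} wins for (b, a); this set lies inside
--     N ∖ C′, so upward closure makes N ∖ C′ win for (b, a), a contradiction.
module Submission where

open import Defs
open import Data.Nat using (ℕ; suc; s≤s; z≤n)
open import Data.Fin using (Fin; zero; suc; _≟_; _<?_)
open import Data.Fin.Properties using (<-asym)
open import Data.Fin.Permutation using (_⟨$⟩ʳ_; _⟨$⟩ˡ_; inverseʳ; inverseˡ)
open import Data.Fin.Subset using (_∈_; ∁; _⊆_)
open import Data.Fin.Subset.Properties using (x∉p⇒x∈∁p)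
open import Data.Vec.Properties using ([]=⇒lookup; lookup⇒[]=; lookup∘tabulate)
open import Data.Product using (proj₂)
open import Data.Sum using (inj₁; inj₂)
open import Data.Empty using (⊥-elim)
open import Relation.Nullary using (¬_; yes; no; does)
open import Relation.Nullary.Decidable using (dec-true)
open import Relation.Binary.PropositionalEquality
open import Function.Bundles using (Equivalence)

module _ {m k : ℕ} (P : Profile m k) (x y : Fin m) where

  ∈coalition⇒≻ : ∀ j → j ∈ coalition P x y → x ≻⟨ P j ⟩ y
  ∈coalition⇒≻ j j∈C with (P j ⟨$⟩ʳ x) <? (P j ⟨$⟩ʳ y) in eq
  ... | yes x≻y = x≻y
  ... | no _ with () ← trans (sym (trans (lookup∘tabulate _ j) (cong does eq)))
                             ([]=⇒lookup j∈C)

  ≻⇒∈coalition : ∀ j → x ≻⟨ P j ⟩ y → j ∈ coalition P x y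
  ≻⇒∈coalition j x≻y =
    lookup⇒[]= j _ (trans (lookup∘tabulate _ j)
                          (dec-true ((P j ⟨$⟩ʳ x) <? (P j ⟨$⟩ʳ y)) x≻y))

reverseCoalition⊆∁ : ∀ {m k} (P : Profile m k) x y →
                     coalition P y x ⊆ ∁ (coalition P x y)
reverseCoalition⊆∁ P x y {j} j∈yx =
  x∉p⇒x∈∁p λ j∈xy → <-asym (∈coalition⇒≻ P x y j j∈xy) (∈coalition⇒≻ P y x j j∈yx)

top≻ : ∀ {m} (R : LinOrd (suc m)) x → x ≢ top R → top R ≻⟨ R ⟩ x
top≻ R x x≢top rewrite inverseʳ R {zero} with R ⟨$⟩ʳ x in eq
... | zero  = ⊥-elim (x≢top (trans (sym (inverseˡ R)) (cong (R ⟨$⟩ˡ_) eq)))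
... | suc _ = s≤s z≤n

topWins : ∀ {m n} (W : Coalitions (suc m) n) (P : Profile (suc m) n) R →
          R represents (λ x y → W x y (coalition P x y)) →
          ∀ x → x ≢ top R → W (top R) x (coalition P (top R) x)
topWins W P R rep x x≢top =
  Equivalence.to (rep (top R) x (λ e → x≢top (sym e))) (top≻ R x x≢top)

deviate-other : ∀ {m n} (P : Profile m n) i R′ j → i ≢ j → deviate P i R′ j ≡ P j
deviate-other P i R′ j i≢j with i ≟ j
... | yes i≡j = ⊥-elim (i≢j i≡j)
... | no _    = refl

deviate-∈ᴰ : ∀ {m n} (D : Domain m) (P : Profile m n) i R′ →
             P ∈ᴰ D → D R′ → deviate P i R′ ∈ᴰ D
deviate-∈ᴰ D P i R′ P∈D R′∈D j with i ≟ j
... | yes _ = R′∈D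
... | no _  = P∈D j

deviate-supports : ∀ {m n} (P : Profile m n) i R′ x y → ¬ (x ≻⟨ P i ⟩ y) →
                   coalition P x y ⊆ coalition (deviate P i R′) x y
deviate-supports P i R′ x y i⊁ {j} j∈C with i ≟ j
... | yes refl = ⊥-elim (i⊁ (∈coalition⇒≻ P x y i j∈C))
... | no i≢j   = ≻⇒∈coalition (deviate P i R′) x y j
    (subst (λ R → x ≻⟨ R ⟩ y) (sym (deviate-other P i R′ j i≢j)) (∈coalition⇒≻ P x y j j∈C))

module _ {m n} {W : Coalitions m n} (S : IsStructureOfWinningCoalitions W) where
  open IsStructureOfWinningCoalitions S

  noDisjointWinners : ∀ x y → x ≢ y → ∀ C C′ →
                      W x y C → W y x C′ → ¬ (C′ ⊆ ∁ C)
  noDisjointWinners x y x≢y C C′ wxy wyx C′⊆∁C =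
    Equivalence.to (duality x y x≢y C) wxy
      (upClosed y x (λ e → x≢y (sym e)) C′ (∁ C) wyx C′⊆∁C)

theorem10 : ∀ (m n : ℕ) (D : Domain (suc m)) (W : Coalitions (suc m) n)
    (RW : Profile (suc m) n → LinOrd (suc m)) →
    IsCondorcet D → IsClosed D →
    IsStructureOfWinningCoalitions W → OrderPreserving D W →
    IsAggregator D W RW →
    StrategyProof D (F RW)
theorem10 m n D W RW _ _ S _ agg i P R′ P∈D R′∈D
  with F RW P ≟ F RW (deviate P i R′)
... | yes a≡b = inj₁ a≡b
... | no a≢b with (P i ⟨$⟩ʳ F RW P) <? (P i ⟨$⟩ʳ F RW (deviate P i R′))
...   | yes a≻b = inj₂ a≻b
...   | no a⊁b  = ⊥-elim (noDisjointWinners S a b a≢b (coalition P′ a b) (coalition P′ b a)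
                               a-wins-after b-wins-after (reverseCoalition⊆∁ P′ a b))
  where
  open IsStructureOfWinningCoalitions S using (upClosed)
  P′ : Profile (suc m) n
  P′ = deviate P i R′
  a b : Fin (suc m)
  a = F RW P
  b = F RW P′

  a-wins-before : W a b (coalition P a b)
  a-wins-before = topWins W P (RW P) (proj₂ (agg P P∈D)) b (λ e → a≢b (sym e))

  a-wins-after : W a b (coalition P′ a b)
  a-wins-after = upClosed a b a≢b _ _ a-wins-before (deviate-supports P i R′ a b a⊁b)

  b-wins-after : W b a (coalition P′ b a)
  b-wins-after = topWins W P′ (RW P′) (proj₂ (agg P′ (deviate-∈ᴰ D P i R′ P∈D R′∈D))) a a≢b
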